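{- Let $G$ be a finite simple connected graph on $\{1,\dots,\ell\}$ and let $d$ be the largest entry of the derivation degree sequence of $D(\mathcal{A}(G))$. Then $d\ge t_{\max}$, where $t_{\max}$ is the largest cardinality of a minimal separator of $G$; i.e. $d\ge|T|$ for every minimal separator $T$ of $G$.
   Context: Let $\mathbb{K}$ be a field, $S=\mathbb{K}[x_1,\dots,x_\ell]$ graded by degree, $D_i=\partial/\partial x_i$. $\mathcal{A}(G)=\{\ker(x_i-x_j):\{i,j\}\in E(G)\}$ and $D(\mathcal{A}(G))=\{\theta\in\mathrm{Der}_{\mathbb{K}}(S):\theta(x_i-x_j)\in(x_i-x_j)S\text{ for all edges }\{i,j\}\}$, a graded $S$-module (polynomial degree of $\sum f_kD_k$ is the common degree of the homogeneous $f_k$). The derivation degree sequence is the ordered sequence of polynomial degrees of the elements of a minimal homogeneous generating set of $D(\mathcal{A}(G))$ (independent of the choice). $T\subseteq V$ with $a,b\notin T$ is a minimal $(a,b)$-separator if every $a$–$b$ path meets $T$ and no proper subset of $T$ has this property; $T$ is a minimal separator of $G$ if it is a minimal $(a,b)$-separator for some $a,b$. -}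

module Defs where

open import Level using (Level; _⊔_; suc)
open import Data.Nat as ℕ using (ℕ; _≤_)
open import Data.Nat.Properties using () renaming (_≟_ to _≟ℕ_)
open import Data.Bool using (Bool; true; false)
open import Data.Fin as Fin using (Fin)
open import Data.Fin.Subset using (Subset; _∈_; _∉_; _⊂_; ∣_∣)
open import Data.List using (List; []; _∷_; _++_; map; concatMap; foldr)
open import Data.List.Relation.Unary.Any using (Any)
open import Data.List.Relation.Unary.Unique.Propositional using (Unique)
open import Data.Vec as Vec using (Vec; zipWith; tabulate)
open import Data.Vec.Properties using (≡-dec)
open import Data.Product using (_×_; _,_; Σ; ∃; ∃-syntax)
open import Relation.Nullary using (¬_; yes; no)
open import Relation.Binary.PropositionalEquality using (_≡_; _≢_)
open import Algebra.Bundles using (CommutativeRing)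

record Field (c ℓ : Level) : Set (Level.suc (c ⊔ ℓ)) where
  field
    commutativeRing : CommutativeRing c ℓ
  open CommutativeRing commutativeRing public
  field
    0≉1     : ¬ (0# ≈ 1#)
    inverse : ∀ x → ¬ (x ≈ 0#) → ∃[ y ] (x * y ≈ 1#)

record SimpleGraph (ℓ : ℕ) : Set where
  field
    adj     : Fin ℓ → Fin ℓ → Bool
    symm    : ∀ i j → adj i j ≡ adj j i
    irrefl  : ∀ i → adj i i ≡ false

module _ {ℓ : ℕ} (G : SimpleGraph ℓ) where
  open SimpleGraph G

  data Walk : Fin ℓ → Fin ℓ → List (Fin ℓ) → Set where
    here : ∀ a → Walk a a (a ∷ [])
    step : ∀ {a b c vs} → adj a b ≡ true → Walk b c vs → Walk a c (a ∷ vs)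

  Path : Fin ℓ → Fin ℓ → List (Fin ℓ) → Set
  Path a b vs = Walk a b vs × Unique vs

  Connected : Set
  Connected = ∀ a b → ∃[ vs ] Path a b vs

  Separates : Subset ℓ → Fin ℓ → Fin ℓ → Set
  Separates T a b = ∀ vs → Path a b vs → Any (λ v → v ∈ T) vs

  IsMinimalSeparatorFor : Subset ℓ → Fin ℓ → Fin ℓ → Set
  IsMinimalSeparatorFor T a b =
    a ∉ T × b ∉ T × Separates T a b ×
    (∀ T′ → T′ ⊂ T → ¬ Separates T′ a b)

  IsMinimalSeparator : Subset ℓ → Set
  IsMinimalSeparator T = ∃[ a ] ∃[ b ] IsMinimalSeparatorFor T a b

-- The polynomial ring S = K[x₁,…,x_ℓ], polynomials represented as finite
-- lists of terms (coefficient , exponent vector); two polynomials are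
-- equal when all their coefficients agree.

module Polynomials {c e : Level} (K : Field c e) (ℓ : ℕ) where
  open Field K

  Monomial : Set
  Monomial = Vec ℕ ℓ

  Poly : Set c
  Poly = List (Carrier × Monomial)

  coeff : Poly → Monomial → Carrier
  coeff []              m = 0#
  coeff ((a , m′) ∷ p)  m with ≡-dec _≟ℕ_ m′ m
  ... | yes _ = a + coeff p m
  ... | no  _ = coeff p m

  _≋_ : Poly → Poly → Set e
  p ≋ q = ∀ m → coeff p m ≈ coeff q m

  totalDegree : Monomial → ℕ
  totalDegree = Vec.foldr _ ℕ._+_ 0

  Homogeneous : ℕ → Poly → Set e
  Homogeneous k p = ∀ m → ¬ (coeff p m ≈ 0#) → totalDegree m ≡ k

  0P : Poly
  0P = []

  _+P_ : Poly → Poly → Poly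
  _+P_ = _++_

  -P_ : Poly → Poly
  -P_ = map (λ { (a , m) → (- a , m) })

  _-P_ : Poly → Poly → Poly
  p -P q = p +P (-P q)

  _*P_ : Poly → Poly → Poly
  p *P q = concatMap (λ { (a , m) → map (λ { (b , n) → (a * b , zipWith ℕ._+_ m n) }) q }) p

  var : Fin ℓ → Poly
  var i = (1# , tabulate (λ j → indicator j)) ∷ []
    where
    indicator : Fin ℓ → ℕ
    indicator j with Fin._≟_ i j
    ... | yes _ = 1
    ... | no  _ = 0

  _∣P_ : Poly → Poly → Set (c ⊔ e)
  f ∣P g = ∃[ q ] (g ≋ (f *P q))

  -- Derivations θ = Σ_k f_k D_k, given by their coefficient family (f_k)
  Der : Set c
  Der = Fin ℓ → Poly

  -- θ applied to the linear form x_i - x_j is f_i - f_j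
  applyDiff : Der → Fin ℓ → Fin ℓ → Poly
  applyDiff θ i j = θ i -P θ j

  HomogeneousDer : ℕ → Der → Set e
  HomogeneousDer k θ = ∀ i → Homogeneous k (θ i)

  sumP : ∀ {n} → (Fin n → Poly) → Poly
  sumP {ℕ.zero}  f = 0P
  sumP {ℕ.suc n} f = f Fin.zero +P sumP (λ r → f (Fin.suc r))

module Arrangement {c e : Level} (K : Field c e) {ℓ : ℕ} (G : SimpleGraph ℓ) where
  open Polynomials K ℓ public
  open SimpleGraph G

  InD : Der → Set (c ⊔ e)
  InD θ = ∀ i j → adj i j ≡ true → (var i -P var j) ∣P applyDiff θ i j

  Generates : ∀ {n} → (Fin n → Der) → Set (c ⊔ e)
  Generates {n} θs = ∀ θ → InD θ →
    Σ (Fin n → Poly) λ g → (∀ k → θ k ≋ sumP {n} (λ r → g r *P θs r k))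

  GeneratesWithout : ∀ {n} → (Fin n → Der) → Fin n → Set (c ⊔ e)
  GeneratesWithout {n} θs r₀ = ∀ θ → InD θ →
    Σ (Fin n → Poly) λ g → ((g r₀ ≋ 0P) × (∀ k → θ k ≋ sumP {n} (λ r → g r *P θs r k)))

  -- a minimal homogeneous generating set of D(A(G)) with n members and
  -- polynomial degrees deg r: members lie in D(A(G)), are homogeneous of
  -- the stated degree, generate, and no proper subfamily generates
  -- (equivalently: dropping any single member destroys generation).
  record MinimalHomogeneousGenerators (n : ℕ) : Set (c ⊔ e) where
    field
      gen         : Fin n → Der
      deg         : Fin n → ℕ
      inD         : ∀ r → InD (gen r)
      homogeneous : ∀ r → HomogeneousDer (deg r) (gen r)
      generates   : Generates gen
      minimal     : ∀ r → ¬ GeneratesWithout gen r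

{-# OPTIONS --safe #-}
-- Let T be a minimal (a, b)-separator and C the set of vertices outside T from which b cannot be
-- reached avoiding T, so that a ∈ C and b ∉ C. The derivation θ with θₖ = ∏_{w ∈ T} (xₖ − x_w)
-- for k ∈ C and θₖ = 0 otherwise lies in D(A(G)): along an edge inside C, xᵢ − xⱼ divides
-- θᵢ − θⱼ, and an edge leaving C ends in T. Moreover θₐ has coefficient ±1 at ∏_{w ∈ T} x_w
-- while θ_b = 0.
-- Now let η ∈ D(A(G)) be homogeneous of degree < |T| and m a monomial in the variables of T.
-- If x_v does not occur in m for some v ∈ T, minimality gives an a–b path avoiding T ∖ {v};
-- across each of its edges xᵢ − xⱼ divides ηᵢ − ηⱼ while m involves neither xᵢ nor xⱼ, so ηₐ
-- and η_b have the same coefficient at m. Otherwise deg m ≥ |T| and both coefficients vanish.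
-- Monomials in the variables of T are closed under division, so this agreement survives
-- polynomial combinations, and θ is not generated by derivations of degree < |T|.
module Submission where

open import Defs
open import Level using (Level)
open import Data.Nat using (ℕ; _≤_)
open import Data.Nat using (zero; suc) renaming (_+_ to _+ℕ_)
open import Data.Fin as Fin using (Fin)
open import Data.Fin.Subset using (Subset; ∣_∣)
open import Data.Product using (∃-syntax; _,_; _×_; proj₂)

open import Data.Bool using (true; false)
open import Data.Fin.Subset using (_∈_; _∉_; _⊂_)
open import Data.Fin.Subset.Properties using (_∈?_)
open import Data.List as List using (List; []; _∷_; map)
open import Data.Vec using (Vec; []; _∷_; lookup; replicate; tabulate; sum)
open import Data.Vec.Base using (here; there)
open import Data.Vec.Properties using (≡-dec; lookup∘tabulate; lookup-replicate)
open import Data.List.Relation.Unary.All using (All; []; _∷_)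
open import Data.Nat.Properties using () renaming (_≟_ to _≟ℕ_)
open import Relation.Nullary using (¬_; Dec; yes; no; contradiction; decidable-stable; _×-dec_)
open import Relation.Binary.PropositionalEquality as ≡ using (_≡_; _≢_; refl)
open import Algebra.Bundles using (CommutativeRing)
open import Effect.Monad using (RawMonad)
open import Relation.Nullary.Negation using (¬¬-Monad; ¬¬-map)
open import Relation.Nullary.Decidable using (¬¬-excluded-middle)

module MonomialArithmetic where
  open Data.Nat using (_+_; _∸_; z≤n)
  open Data.Vec using (zipWith)
  open import Data.Nat.Properties
    using (+-comm; +-assoc; +-identityˡ; m+n∸m≡n; m+n≡0⇒m≡0; n≢0⇒n>0; ≤-trans; m≤n+m; +-mono-≤)
  open import Data.Vec.Properties
    using (zipWith-comm; zipWith-assoc; zipWith-identityˡ; lookup-zipWith; ∷-injective)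
  open ≡.≡-Reasoning

  infixl 6 _⊕_ _⊝_
  infix 4 _≼_

  _⊕_ : ∀ {n} → Vec ℕ n → Vec ℕ n → Vec ℕ n
  _⊕_ = zipWith _+_

  _⊝_ : ∀ {n} → Vec ℕ n → Vec ℕ n → Vec ℕ n
  _⊝_ = zipWith _∸_

  -- Divisibility of monomials, stated as an equation (⊝ truncates) so that Vec's ≡-dec decides it.
  _≼_ : ∀ {n} → Vec ℕ n → Vec ℕ n → Set
  m₁ ≼ m = m₁ ⊕ (m ⊝ m₁) ≡ m

  ⊕-comm : ∀ {n} (m₁ m₂ : Vec ℕ n) → m₁ ⊕ m₂ ≡ m₂ ⊕ m₁
  ⊕-comm = zipWith-comm +-comm

  ⊕-assoc : ∀ {n} (m₁ m₂ m₃ : Vec ℕ n) → (m₁ ⊕ m₂) ⊕ m₃ ≡ m₁ ⊕ (m₂ ⊕ m₃)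
  ⊕-assoc = zipWith-assoc +-assoc

  ⊕-identityˡ : ∀ {n} (m : Vec ℕ n) → replicate n 0 ⊕ m ≡ m
  ⊕-identityˡ = zipWith-identityˡ +-identityˡ

  lookup-⊕ : ∀ {n} (m₁ m₂ : Vec ℕ n) k → lookup (m₁ ⊕ m₂) k ≡ lookup m₁ k + lookup m₂ k
  lookup-⊕ m₁ m₂ k = lookup-zipWith _+_ k m₁ m₂

  lookup-⊝ : ∀ {n} (m₁ m₂ : Vec ℕ n) k → lookup (m₁ ⊝ m₂) k ≡ lookup m₁ k ∸ lookup m₂ k
  lookup-⊝ m₁ m₂ k = lookup-zipWith _∸_ k m₁ m₂

  m⊕n≡o⇒n≡o⊝m : ∀ {k} {m n o : Vec ℕ k} → m ⊕ n ≡ o → n ≡ o ⊝ m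
  m⊕n≡o⇒n≡o⊝m {m = []}    {[]}    {[]}    refl = refl
  m⊕n≡o⇒n≡o⊝m {m = x ∷ m} {y ∷ n} {z ∷ o} eq with ∷-injective eq
  ... | refl , eq′ = ≡.cong₂ _∷_ (≡.sym (m+n∸m≡n x y)) (m⊕n≡o⇒n≡o⊝m eq′)

  ≼-lookup-zero : ∀ {n} {m₁ m : Vec ℕ n} i → m₁ ≼ m → lookup m i ≡ 0 → lookup m₁ i ≡ 0
  ≼-lookup-zero {m₁ = m₁} {m} i m₁≼m mᵢ≡0 = m+n≡0⇒m≡0 (lookup m₁ i) (begin
    lookup m₁ i + lookup (m ⊝ m₁) i  ≡⟨ lookup-⊕ m₁ (m ⊝ m₁) i ⟨
    lookup (m₁ ⊕ (m ⊝ m₁)) i         ≡⟨ ≡.cong (λ v → lookup v i) m₁≼m ⟩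
    lookup m i                       ≡⟨ mᵢ≡0 ⟩
    0                                ∎)

  ∣p∣≤sum : ∀ {n} (p : Subset n) (m : Vec ℕ n) → (∀ i → i ∈ p → lookup m i ≢ 0) → ∣ p ∣ ≤ sum m
  ∣p∣≤sum []          []      _  = z≤n
  ∣p∣≤sum (true ∷ p)  (x ∷ m) nz =
    +-mono-≤ (n≢0⇒n>0 (nz Fin.zero here)) (∣p∣≤sum p m λ i i∈p → nz (Fin.suc i) (there i∈p))
  ∣p∣≤sum (false ∷ p) (x ∷ m) nz =
    ≤-trans (∣p∣≤sum p m λ i i∈p → nz (Fin.suc i) (there i∈p)) (m≤n+m _ x)

open MonomialArithmetic

module LinearProducts {c e : Level} (R : CommutativeRing c e) {ℓ : ℕ}
                      (x : Fin ℓ → CommutativeRing.Carrier R) where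
  open CommutativeRing R hiding (refl)
  open import Algebra.Properties.Ring ring using (x[y-z]≈xy-xz; -‿distribʳ-*; -0#≈0#)
  open import Algebra.Properties.AbelianGroup +-abelianGroup using (⁻¹-anti-homo‿-)
  open import Algebra.Properties.CommutativeSemigroup.Divisibility *-commutativeSemigroup
    using (_∣_; _,_; x∣xy; x∣ʳy⇒x∣ʳzy; ∣-respʳ-≈)
  open import Algebra.Properties.Semiring.Divisibility semiring using (_∣0)
  open import Data.List.Membership.Propositional using () renaming (_∈_ to _∈ₗ_)
  open import Data.List.Relation.Unary.Any using (here; there)
  open import Relation.Binary.Reasoning.Setoid setoid

  linearProduct : Fin ℓ → List (Fin ℓ) → Carrier
  linearProduct k = List.foldr (λ w p → (x k - x w) * p) 1#

  ∣-+ : ∀ {a b d} → a ∣ b → a ∣ d → a ∣ b + d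
  ∣-+ {a} {b} {d} (p , pa≈b) (q , qa≈d) = p + q , (begin
    (p + q) * a    ≈⟨ distribʳ a p q ⟩
    p * a + q * a  ≈⟨ +-cong pa≈b qa≈d ⟩
    b + d          ∎)

  x-y+y-z≈x-z : ∀ a b d → (a - b) + (b - d) ≈ a - d
  x-y+y-z≈x-z a b d = begin
    (a - b) + (b - d)      ≈⟨ +-assoc a (- b) (b - d) ⟩
    a + (- b + (b - d))    ≈⟨ +-congˡ (+-assoc (- b) b (- d)) ⟨
    a + ((- b + b) - d)    ≈⟨ +-congˡ (+-congʳ (-‿inverseˡ b)) ⟩
    a + (0# - d)           ≈⟨ +-congˡ (+-identityˡ (- d)) ⟩
    a - d                  ∎

  x-x∣linearProduct : ∀ {k w ws} → w ∈ₗ ws → x k - x w ∣ linearProduct k ws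
  x-x∣linearProduct {k} {w} (here refl) = x∣xy (x k - x w) _
  x-x∣linearProduct {k} {ws = w′ ∷ _} (there w∈ws) = x∣ʳy⇒x∣ʳzy (x k - x w′) (x-x∣linearProduct w∈ws)

  x-x∣linearProduct-difference : ∀ i j ws → x i - x j ∣ linearProduct i ws - linearProduct j ws
  x-x∣linearProduct-difference i j []       = 0# , (begin
    0# * (x i - x j)  ≈⟨ zeroˡ _ ⟩
    0#                ≈⟨ -‿inverseʳ 1# ⟨
    1# - 1#           ∎)
  x-x∣linearProduct-difference i j (w ∷ ws) = ∣-respʳ-≈ split
    (∣-+ (x∣xy (x i - x j) Lᵢ) (x∣ʳy⇒x∣ʳzy (x j - x w) (x-x∣linearProduct-difference i j ws)))
    where
    Lᵢ = linearProduct i ws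
    Lⱼ = linearProduct j ws
    split : (x i - x j) * Lᵢ + (x j - x w) * (Lᵢ - Lⱼ) ≈ (x i - x w) * Lᵢ - (x j - x w) * Lⱼ
    split = begin
      (x i - x j) * Lᵢ + (x j - x w) * (Lᵢ - Lⱼ)
        ≈⟨ +-congˡ (x[y-z]≈xy-xz (x j - x w) Lᵢ Lⱼ) ⟩
      (x i - x j) * Lᵢ + ((x j - x w) * Lᵢ - (x j - x w) * Lⱼ)
        ≈⟨ +-assoc _ _ _ ⟨
      ((x i - x j) * Lᵢ + (x j - x w) * Lᵢ) - (x j - x w) * Lⱼ
        ≈⟨ +-congʳ (distribʳ Lᵢ (x i - x j) (x j - x w)) ⟨
      ((x i - x j) + (x j - x w)) * Lᵢ - (x j - x w) * Lⱼ
        ≈⟨ +-congʳ (*-congʳ (x-y+y-z≈x-z (x i) (x j) (x w))) ⟩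
      (x i - x w) * Lᵢ - (x j - x w) * Lⱼ
        ∎

  infixl 7 _when_
  _when_ : ∀ {P : Set} → Carrier → Dec P → Carrier
  a when yes _ = a
  a when no  _ = 0#

  when-yes : ∀ {P : Set} {a} (P? : Dec P) → P → a when P? ≡ a
  when-yes (yes _) _ = refl
  when-yes (no ¬p) p = contradiction p ¬p

  when-no : ∀ {P : Set} {a} (P? : Dec P) → ¬ P → a when P? ≡ 0#
  when-no (yes p) ¬p = contradiction p ¬p
  when-no (no _)  _  = refl

  x-x∣linearProduct-when-difference : ∀ {P Q : Set} i j ws (P? : Dec P) (Q? : Dec Q) →
    (P → ¬ Q → j ∈ₗ ws) → (Q → ¬ P → i ∈ₗ ws) →
    x i - x j ∣ linearProduct i ws when P? - linearProduct j ws when Q?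
  x-x∣linearProduct-when-difference i j ws (yes p) (yes q) _ _ = x-x∣linearProduct-difference i j ws
  x-x∣linearProduct-when-difference i j ws (yes p) (no ¬q) j∈ws _ =
    ∣-respʳ-≈ (sym (trans (+-congˡ -0#≈0#) (+-identityʳ _))) (x-x∣linearProduct (j∈ws p ¬q))
  x-x∣linearProduct-when-difference i j ws (no ¬p) (yes q) _ i∈ws with x-x∣linearProduct {j} (i∈ws q ¬p)
  ... | r , r[xⱼ-xᵢ]≈Lⱼ = r , (begin
    r * (x i - x j)        ≈⟨ *-congˡ (⁻¹-anti-homo‿- (x j) (x i)) ⟨
    r * - (x j - x i)      ≈⟨ -‿distribʳ-* r (x j - x i) ⟨
    - (r * (x j - x i))    ≈⟨ -‿cong r[xⱼ-xᵢ]≈Lⱼ ⟩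
    - linearProduct j ws   ≈⟨ +-identityˡ _ ⟨
    0# - linearProduct j ws ∎)
  x-x∣linearProduct-when-difference i j ws (no ¬p) (no ¬q) _ _ =
    ∣-respʳ-≈ (sym (-‿inverseʳ 0#)) ((x i - x j) ∣0)

module PolynomialRing {c e : Level} (K : Field c e) (ℓ : ℕ) where
  open Field K renaming (refl to ≈-refl; sym to ≈-sym; trans to ≈-trans)
  open Polynomials K ℓ
  open import Algebra.Properties.Ring ring using (-0#≈0#; -‿+-comm)
  open import Algebra.Properties.CommutativeSemigroup +-commutativeSemigroup
    using () renaming (interchange to +-interchange)
  open import Relation.Binary.Reasoning.Setoid setoid
  open import Data.List.Properties using (++-assoc; ++-identityʳ; map-++; concatMap-++)
  open import Algebra.Structures using (IsCommutativeRing)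
  open import Relation.Binary.Structures using (IsEquivalence)

  δ : Monomial → Monomial → Carrier → Carrier
  δ m′ m a with ≡-dec _≟ℕ_ m′ m
  ... | yes _ = a
  ... | no  _ = 0#

  δ-≡ : ∀ {m′ m} a → m′ ≡ m → δ m′ m a ≈ a
  δ-≡ {m′} {m} a eq with ≡-dec _≟ℕ_ m′ m
  ... | yes _  = ≈-refl
  ... | no m′≢m = contradiction eq m′≢m

  δ-≢ : ∀ {m′ m} a → m′ ≢ m → δ m′ m a ≈ 0#
  δ-≢ {m′} {m} a m′≢m with ≡-dec _≟ℕ_ m′ m
  ... | yes eq = contradiction eq m′≢m
  ... | no _   = ≈-refl

  δ-cong : ∀ m′ m {a b} → a ≈ b → δ m′ m a ≈ δ m′ m b
  δ-cong m′ m a≈b with ≡-dec _≟ℕ_ m′ m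
  ... | yes _ = a≈b
  ... | no  _ = ≈-refl

  δ-neg : ∀ m′ m a → δ m′ m (- a) ≈ - δ m′ m a
  δ-neg m′ m a with ≡-dec _≟ℕ_ m′ m
  ... | yes _ = ≈-refl
  ... | no  _ = ≈-sym -0#≈0#

  coeff-∷ : ∀ a m′ p m → coeff ((a , m′) ∷ p) m ≈ δ m′ m a + coeff p m
  coeff-∷ a m′ p m with ≡-dec _≟ℕ_ m′ m
  ... | yes _ = ≈-refl
  ... | no  _ = ≈-sym (+-identityˡ _)

  coeff-+P : ∀ p q m → coeff (p +P q) m ≈ coeff p m + coeff q m
  coeff-+P []             q m = ≈-sym (+-identityˡ _)
  coeff-+P ((a , m′) ∷ p) q m = begin
    coeff ((a , m′) ∷ (p +P q)) m       ≈⟨ coeff-∷ a m′ (p +P q) m ⟩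
    δ m′ m a + coeff (p +P q) m         ≈⟨ +-congˡ (coeff-+P p q m) ⟩
    δ m′ m a + (coeff p m + coeff q m)  ≈⟨ +-assoc _ _ _ ⟨
    (δ m′ m a + coeff p m) + coeff q m  ≈⟨ +-congʳ (coeff-∷ a m′ p m) ⟨
    coeff ((a , m′) ∷ p) m + coeff q m  ∎

  coeff-negP : ∀ p m → coeff (-P p) m ≈ - coeff p m
  coeff-negP []             m = ≈-sym -0#≈0#
  coeff-negP ((a , m′) ∷ p) m = begin
    coeff ((- a , m′) ∷ -P p) m    ≈⟨ coeff-∷ (- a) m′ (-P p) m ⟩
    δ m′ m (- a) + coeff (-P p) m  ≈⟨ +-cong (δ-neg m′ m a) (coeff-negP p m) ⟩
    - δ m′ m a + - coeff p m       ≈⟨ -‿+-comm _ _ ⟩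
    - (δ m′ m a + coeff p m)       ≈⟨ -‿cong (coeff-∷ a m′ p m) ⟨
    - coeff ((a , m′) ∷ p) m       ∎

  infix 4 _≃_
  record _≃_ (p q : Poly) : Set e where
    constructor mk≃
    field coeff-≈ : p ≋ q
  open _≃_ public

  ≃-refl : ∀ {p} → p ≃ p
  ≃-refl = mk≃ λ _ → ≈-refl

  ≃-sym : ∀ {p q} → p ≃ q → q ≃ p
  ≃-sym p≃q = mk≃ λ m → ≈-sym (coeff-≈ p≃q m)

  ≃-trans : ∀ {p q r} → p ≃ q → q ≃ r → p ≃ r
  ≃-trans p≃q q≃r = mk≃ λ m → ≈-trans (coeff-≈ p≃q m) (coeff-≈ q≃r m)

  ≡⇒≃ : ∀ {p q} → p ≡ q → p ≃ q
  ≡⇒≃ refl = ≃-refl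

  ∷-cong : ∀ {a b m m′ p q} → a ≈ b → m ≡ m′ → p ≃ q → (a , m) ∷ p ≃ (b , m′) ∷ q
  ∷-cong {a} {b} {m′} {_} {p} {q} a≈b refl p≃q = mk≃ λ m → begin
    coeff ((a , m′) ∷ p) m  ≈⟨ coeff-∷ a m′ p m ⟩
    δ m′ m a + coeff p m    ≈⟨ +-cong (δ-cong m′ m a≈b) (coeff-≈ p≃q m) ⟩
    δ m′ m b + coeff q m    ≈⟨ coeff-∷ b m′ q m ⟨
    coeff ((b , m′) ∷ q) m  ∎

  +P-cong : ∀ {p p′ q q′} → p ≃ p′ → q ≃ q′ → p +P q ≃ p′ +P q′
  +P-cong {p} {p′} {q} {q′} p≃p′ q≃q′ = mk≃ λ m → begin
    coeff (p +P q) m          ≈⟨ coeff-+P p q m ⟩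
    coeff p m + coeff q m     ≈⟨ +-cong (coeff-≈ p≃p′ m) (coeff-≈ q≃q′ m) ⟩
    coeff p′ m + coeff q′ m   ≈⟨ coeff-+P p′ q′ m ⟨
    coeff (p′ +P q′) m        ∎

  -P-cong : ∀ {p q} → p ≃ q → -P p ≃ -P q
  -P-cong {p} {q} p≃q = mk≃ λ m → begin
    coeff (-P p) m  ≈⟨ coeff-negP p m ⟩
    - coeff p m     ≈⟨ -‿cong (coeff-≈ p≃q m) ⟩
    - coeff q m     ≈⟨ coeff-negP q m ⟨
    coeff (-P q) m  ∎

  +P-comm : ∀ p q → p +P q ≃ q +P p
  +P-comm p q = mk≃ λ m → begin
    coeff (p +P q) m       ≈⟨ coeff-+P p q m ⟩
    coeff p m + coeff q m  ≈⟨ +-comm _ _ ⟩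
    coeff q m + coeff p m  ≈⟨ coeff-+P q p m ⟨
    coeff (q +P p) m       ∎

  -P‿inverseˡ : ∀ p → (-P p) +P p ≃ 0P
  -P‿inverseˡ p = mk≃ λ m → begin
    coeff ((-P p) +P p) m        ≈⟨ coeff-+P (-P p) p m ⟩
    coeff (-P p) m + coeff p m   ≈⟨ +-congʳ (coeff-negP p m) ⟩
    - coeff p m + coeff p m      ≈⟨ -‿inverseˡ _ ⟩
    0#                           ∎

  Term : Set c
  Term = Carrier × Monomial

  infixr 7 _·_
  _·_ : Term → Poly → Poly
  (a , m₁) · q = map (λ (b , n) → (a * b , m₁ ⊕ n)) q

  δ-⊕ : ∀ {m₁ m} n a b → m₁ ≼ m → δ (m₁ ⊕ n) m (a * b) ≈ a * δ n (m ⊝ m₁) b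
  δ-⊕ {m₁} {m} n a b m₁≼m = by-cases (≡-dec _≟ℕ_ n (m ⊝ m₁))
    where
    by-cases : Dec (n ≡ m ⊝ m₁) → δ (m₁ ⊕ n) m (a * b) ≈ a * δ n (m ⊝ m₁) b
    by-cases (yes refl) = ≈-trans (δ-≡ (a * b) m₁≼m) (*-congˡ (≈-sym (δ-≡ {m ⊝ m₁} b refl)))
    by-cases (no n≢)    = begin
      δ (m₁ ⊕ n) m (a * b)  ≈⟨ δ-≢ (a * b) (λ eq → n≢ (m⊕n≡o⇒n≡o⊝m eq)) ⟩
      0#                    ≈⟨ zeroʳ a ⟨
      a * 0#                ≈⟨ *-congˡ (δ-≢ b n≢) ⟨
      a * δ n (m ⊝ m₁) b    ∎

  coeff-·-≼ : ∀ a {m₁ m} q → m₁ ≼ m → coeff ((a , m₁) · q) m ≈ a * coeff q (m ⊝ m₁)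
  coeff-·-≼ a []             m₁≼m = ≈-sym (zeroʳ a)
  coeff-·-≼ a {m₁} {m} ((b , n) ∷ q) m₁≼m = begin
    coeff ((a , m₁) · ((b , n) ∷ q)) m             ≈⟨ coeff-∷ (a * b) (m₁ ⊕ n) ((a , m₁) · q) m ⟩
    δ (m₁ ⊕ n) m (a * b) + coeff ((a , m₁) · q) m  ≈⟨ +-cong (δ-⊕ n a b m₁≼m) (coeff-·-≼ a q m₁≼m) ⟩
    a * δ n (m ⊝ m₁) b + a * coeff q (m ⊝ m₁)      ≈⟨ distribˡ a _ _ ⟨
    a * (δ n (m ⊝ m₁) b + coeff q (m ⊝ m₁))        ≈⟨ *-congˡ (coeff-∷ b n q (m ⊝ m₁)) ⟨
    a * coeff ((b , n) ∷ q) (m ⊝ m₁)               ∎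

  coeff-·-⋠ : ∀ a {m₁ m} q → ¬ m₁ ≼ m → coeff ((a , m₁) · q) m ≈ 0#
  coeff-·-⋠ a []             m₁⋠m = ≈-refl
  coeff-·-⋠ a {m₁} {m} ((b , n) ∷ q) m₁⋠m = begin
    coeff ((a , m₁) · ((b , n) ∷ q)) m             ≈⟨ coeff-∷ (a * b) (m₁ ⊕ n) ((a , m₁) · q) m ⟩
    δ (m₁ ⊕ n) m (a * b) + coeff ((a , m₁) · q) m  ≈⟨ +-cong (δ-≢ (a * b) m₁⊕n≢m) (coeff-·-⋠ a q m₁⋠m) ⟩
    0# + 0#                                        ≈⟨ +-identityˡ 0# ⟩
    0#                                             ∎
    where
    m₁⊕n≢m : m₁ ⊕ n ≢ m
    m₁⊕n≢m eq = m₁⋠m (≡.subst (λ n′ → m₁ ⊕ n′ ≡ m) (m⊕n≡o⇒n≡o⊝m eq) eq)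

  ·-congʳ : ∀ t {q q′} → q ≃ q′ → t · q ≃ t · q′
  ·-congʳ (a , m₁) {q} {q′} q≃q′ = mk≃ λ m → by-cases m (≡-dec _≟ℕ_ (m₁ ⊕ (m ⊝ m₁)) m)
    where
    by-cases : ∀ m → Dec (m₁ ≼ m) → coeff ((a , m₁) · q) m ≈ coeff ((a , m₁) · q′) m
    by-cases m (yes m₁≼m) = begin
      coeff ((a , m₁) · q) m    ≈⟨ coeff-·-≼ a q m₁≼m ⟩
      a * coeff q (m ⊝ m₁)      ≈⟨ *-congˡ (coeff-≈ q≃q′ (m ⊝ m₁)) ⟩
      a * coeff q′ (m ⊝ m₁)     ≈⟨ coeff-·-≼ a q′ m₁≼m ⟨
      coeff ((a , m₁) · q′) m   ∎
    by-cases m (no m₁⋠m) = ≈-trans (coeff-·-⋠ a q m₁⋠m) (≈-sym (coeff-·-⋠ a q′ m₁⋠m))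

  ∑ : ∀ {A : Set c} → List A → (A → Carrier) → Carrier
  ∑ []       f = 0#
  ∑ (x ∷ xs) f = f x + ∑ xs f

  ∑-cong : ∀ {A : Set c} xs {f g : A → Carrier} → (∀ x → f x ≈ g x) → ∑ xs f ≈ ∑ xs g
  ∑-cong []       f≈g = ≈-refl
  ∑-cong (x ∷ xs) f≈g = +-cong (f≈g x) (∑-cong xs f≈g)

  ∑-zero : ∀ {A : Set c} (xs : List A) → ∑ xs (λ _ → 0#) ≈ 0#
  ∑-zero []       = ≈-refl
  ∑-zero (x ∷ xs) = ≈-trans (+-identityˡ _) (∑-zero xs)

  ∑-+ : ∀ {A : Set c} xs (f g : A → Carrier) → ∑ xs (λ x → f x + g x) ≈ ∑ xs f + ∑ xs g
  ∑-+ []       f g = ≈-sym (+-identityˡ 0#)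
  ∑-+ (x ∷ xs) f g = ≈-trans (+-congˡ (∑-+ xs f g)) (+-interchange _ _ _ _)

  ∑-swap : ∀ {A B : Set c} xs ys (f : A → B → Carrier) →
           ∑ xs (λ x → ∑ ys (f x)) ≈ ∑ ys (λ y → ∑ xs (λ x → f x y))
  ∑-swap []       ys f = ≈-sym (∑-zero ys)
  ∑-swap (x ∷ xs) ys f =
    ≈-trans (+-congˡ (∑-swap xs ys f)) (≈-sym (∑-+ ys (f x) (λ y → ∑ xs (λ x′ → f x′ y))))

  coeff-*P : ∀ p q m → coeff (p *P q) m ≈ ∑ p (λ (a , m₁) → ∑ q (λ (b , n) → δ (m₁ ⊕ n) m (a * b)))
  coeff-*P []             q m = ≈-refl
  coeff-*P ((a , m₁) ∷ p) q m =
    ≈-trans (coeff-+P ((a , m₁) · q) (p *P q) m) (+-cong (coeff-· q) (coeff-*P p q m))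
    where
    coeff-· : ∀ q → coeff ((a , m₁) · q) m ≈ ∑ q (λ (b , n) → δ (m₁ ⊕ n) m (a * b))
    coeff-· []             = ≈-refl
    coeff-· ((b , n) ∷ q) = ≈-trans (coeff-∷ (a * b) (m₁ ⊕ n) ((a , m₁) · q) m) (+-congˡ (coeff-· q))

  *P-comm : ∀ p q → p *P q ≃ q *P p
  *P-comm p q = mk≃ λ m → begin
    coeff (p *P q) m
      ≈⟨ coeff-*P p q m ⟩
    ∑ p (λ (a , m₁) → ∑ q (λ (b , n) → δ (m₁ ⊕ n) m (a * b)))
      ≈⟨ ∑-swap p q _ ⟩
    ∑ q (λ (b , n) → ∑ p (λ (a , m₁) → δ (m₁ ⊕ n) m (a * b)))
      ≈⟨ ∑-cong q (λ (b , n) → ∑-cong p (λ (a , m₁) →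
           ≈-trans (reflexive (≡.cong (λ m′ → δ m′ m (a * b)) (⊕-comm m₁ n)))
                   (δ-cong (n ⊕ m₁) m (*-comm a b)))) ⟩
    ∑ q (λ (b , n) → ∑ p (λ (a , m₁) → δ (n ⊕ m₁) m (b * a)))
      ≈⟨ coeff-*P q p m ⟨
    coeff (q *P p) m
      ∎

  *P-congˡ : ∀ p {q q′} → q ≃ q′ → p *P q ≃ p *P q′
  *P-congˡ []      q≃q′ = ≃-refl
  *P-congˡ (t ∷ p) q≃q′ = +P-cong (·-congʳ t q≃q′) (*P-congˡ p q≃q′)

  *P-cong : ∀ {p p′ q q′} → p ≃ p′ → q ≃ q′ → p *P q ≃ p′ *P q′
  *P-cong {p} {p′} {q} {q′} p≃p′ q≃q′ =
    ≃-trans (*P-congˡ p q≃q′) (≃-trans (*P-comm p q′) (≃-trans (*P-congˡ q′ p≃p′) (*P-comm q′ p′)))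

  *P-distribʳ : ∀ q p p′ → (p +P p′) *P q ≡ (p *P q) +P (p′ *P q)
  *P-distribʳ q p p′ = concatMap-++ _ p p′

  ·-+P : ∀ t q q′ → t · (q +P q′) ≡ (t · q) +P (t · q′)
  ·-+P (a , m₁) q q′ = map-++ _ q q′

  ·-· : ∀ a m₁ b n r → (a * b , m₁ ⊕ n) · r ≃ (a , m₁) · ((b , n) · r)
  ·-· a m₁ b n []            = ≃-refl
  ·-· a m₁ b n ((x , o) ∷ r) = ∷-cong (*-assoc a b x) (⊕-assoc m₁ n o) (·-· a m₁ b n r)

  ·-*P : ∀ t q r → (t · q) *P r ≃ t · (q *P r)
  ·-*P (a , m₁) []            r = ≃-refl
  ·-*P (a , m₁) ((b , n) ∷ q) r = ≃-trans (+P-cong (·-· a m₁ b n r) (·-*P (a , m₁) q r))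
                                          (≡⇒≃ (≡.sym (·-+P (a , m₁) ((b , n) · r) (q *P r))))

  *P-assoc : ∀ p q r → (p *P q) *P r ≃ p *P (q *P r)
  *P-assoc []      q r = ≃-refl
  *P-assoc (t ∷ p) q r =
    ≃-trans (≡⇒≃ (*P-distribʳ r (t · q) (p *P q))) (+P-cong (·-*P t q r) (*P-assoc p q r))

  1P : Poly
  1P = (1# , replicate ℓ 0) ∷ []

  *P-identityˡ : ∀ p → 1P *P p ≃ p
  *P-identityˡ p = ≃-trans (≡⇒≃ (++-identityʳ ((1# , replicate ℓ 0) · p))) (unit· p)
    where
    unit· : ∀ p → (1# , replicate ℓ 0) · p ≃ p
    unit· []            = ≃-refl
    unit· ((a , m) ∷ p) = ∷-cong (*-identityˡ a) (⊕-identityˡ m) (unit· p)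

  +P-*P-isCommutativeRing : IsCommutativeRing _≃_ _+P_ _*P_ -P_ 0P 1P
  +P-*P-isCommutativeRing = record
    { isRing = record
      { +-isAbelianGroup = record
        { isGroup = record
          { isMonoid = record
            { isSemigroup = record
              { isMagma = record { isEquivalence = ≃-isEquivalence ; ∙-cong = +P-cong }
              ; assoc = λ p q r → ≡⇒≃ (++-assoc p q r)
              }
            ; identity = (λ p → ≃-refl) , (λ p → ≡⇒≃ (++-identityʳ p))
            }
          ; inverse = -P‿inverseˡ , λ p → ≃-trans (+P-comm p (-P p)) (-P‿inverseˡ p)
          ; ⁻¹-cong = -P-cong
          }
        ; comm = +P-comm
        }
      ; *-cong = *P-cong
      ; *-assoc = *P-assoc
      ; *-identity = *P-identityˡ , λ p → ≃-trans (*P-comm p 1P) (*P-identityˡ p)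
      ; distrib = (λ p q r → ≃-trans (*P-comm p (q +P r))
                               (≃-trans (≡⇒≃ (*P-distribʳ p q r)) (+P-cong (*P-comm q p) (*P-comm r p))))
                , (λ p q r → ≡⇒≃ (*P-distribʳ p q r))
      }
    ; *-comm = *P-comm
    }
    where
    ≃-isEquivalence : IsEquivalence _≃_
    ≃-isEquivalence = record { refl = ≃-refl ; sym = ≃-sym ; trans = ≃-trans }

  +P-*P-commutativeRing : CommutativeRing c e
  +P-*P-commutativeRing = record { isCommutativeRing = +P-*P-isCommutativeRing }

module LinearFormCoefficients {c e : Level} (K : Field c e) (ℓ : ℕ) where
  open Field K renaming (refl to ≈-refl; sym to ≈-sym; trans to ≈-trans)
  open Polynomials K ℓ
  open PolynomialRing K ℓ
  open import Algebra.Properties.Ring ring using (-0#≈0#; -‿involutive; -1*x≈-x)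
  open import Data.Nat.Properties using (1+n≢0)
  open import Relation.Binary.Reasoning.Setoid setoid

  unit : Fin ℓ → Monomial
  unit i = proj₂ (List.lookup (var i) Fin.zero)

  -- var i tabulates a with-bound indicator function that cannot be named here; this lets unification find it.
  lookup-tabulated : ∀ {f : Fin ℓ → ℕ} (v : Monomial) → v ≡ tabulate f → ∀ k → lookup v k ≡ f k
  lookup-tabulated v refl k = lookup∘tabulate _ k

  lookup-unit-≡ : ∀ i → lookup (unit i) i ≡ 1
  lookup-unit-≡ i with i Fin.≟ i | lookup-tabulated (unit i) refl i
  ... | yes _   | eq = eq
  ... | no  i≢i | _  = contradiction refl i≢i

  lookup-unit-≢ : ∀ {i k} → i ≢ k → lookup (unit i) k ≡ 0
  lookup-unit-≢ {i} {k} i≢k with i Fin.≟ k | lookup-tabulated (unit i) refl k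
  ... | yes i≡k | _  = contradiction i≡k i≢k
  ... | no  _   | eq = eq

  coeff-unit·-vanishes : ∀ a i q {m} → lookup m i ≡ 0 → coeff ((a , unit i) · q) m ≈ 0#
  coeff-unit·-vanishes a i q mᵢ≡0 = coeff-·-⋠ a q λ unit≼m →
    1+n≢0 (≡.trans (≡.sym (lookup-unit-≡ i)) (≼-lookup-zero i unit≼m mᵢ≡0))

  coeff-x-x*P : ∀ i j p m →
                coeff ((var i -P var j) *P p) m ≈ coeff ((1# , unit i) · p) m + coeff ((- 1# , unit j) · p) m
  coeff-x-x*P i j p m = ≈-trans (coeff-+P ((1# , unit i) · p) _ m)
                                (+-congˡ (≈-trans (coeff-+P ((- 1# , unit j) · p) 0P m) (+-identityʳ _)))

  coeff-x-x*P-vanishes : ∀ i j p {m} → lookup m i ≡ 0 → lookup m j ≡ 0 → coeff ((var i -P var j) *P p) m ≈ 0#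
  coeff-x-x*P-vanishes i j p {m} mᵢ≡0 mⱼ≡0 = begin
    coeff ((var i -P var j) *P p) m                              ≈⟨ coeff-x-x*P i j p m ⟩
    coeff ((1# , unit i) · p) m + coeff ((- 1# , unit j) · p) m  ≈⟨ +-cong (coeff-unit·-vanishes 1# i p mᵢ≡0)
                                                                            (coeff-unit·-vanishes (- 1#) j p mⱼ≡0) ⟩
    0# + 0#                                                      ≈⟨ +-identityˡ 0# ⟩
    0#                                                           ∎

  coeff-x-x*P-shift : ∀ {k w} p m → w ≢ k → lookup m k ≡ 0 →
                      coeff ((var k -P var w) *P p) (unit w ⊕ m) ≈ - coeff p m
  coeff-x-x*P-shift {k} {w} p m w≢k mₖ≡0 = begin
    coeff ((var k -P var w) *P p) (unit w ⊕ m)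
      ≈⟨ coeff-x-x*P k w p (unit w ⊕ m) ⟩
    coeff ((1# , unit k) · p) (unit w ⊕ m) + coeff ((- 1# , unit w) · p) (unit w ⊕ m)
      ≈⟨ +-congʳ (coeff-unit·-vanishes 1# k p [unit-w⊕m]ₖ≡0) ⟩
    0# + coeff ((- 1# , unit w) · p) (unit w ⊕ m)
      ≈⟨ +-identityˡ _ ⟩
    coeff ((- 1# , unit w) · p) (unit w ⊕ m)
      ≈⟨ coeff-·-≼ (- 1#) p (≡.cong (unit w ⊕_) (≡.sym m≡)) ⟩
    - 1# * coeff p ((unit w ⊕ m) ⊝ unit w)
      ≈⟨ *-congˡ (reflexive (≡.cong (coeff p) (≡.sym m≡))) ⟩
    - 1# * coeff p m
      ≈⟨ -1*x≈-x _ ⟩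
    - coeff p m
      ∎
    where
    [unit-w⊕m]ₖ≡0 : lookup (unit w ⊕ m) k ≡ 0
    [unit-w⊕m]ₖ≡0 = ≡.trans (lookup-⊕ (unit w) m k) (≡.cong₂ _+ℕ_ (lookup-unit-≢ w≢k) mₖ≡0)
    m≡ : m ≡ (unit w ⊕ m) ⊝ unit w
    m≡ = m⊕n≡o⇒n≡o⊝m refl

  open LinearProducts +P-*P-commutativeRing var public using (linearProduct)

  module _ where
    open import Algebra.Properties.CommutativeSemigroup.Divisibility
      (CommutativeRing.*-commutativeSemigroup +P-*P-commutativeRing) using (_∣_; _,_)

    ∣⇒∣P : ∀ {f g} → f ∣ g → f ∣P g
    ∣⇒∣P {f} (q , q*f≃g) = q , coeff-≈ (≃-trans (≃-sym q*f≃g) (*P-comm q f))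

  productMonomial : List (Fin ℓ) → Monomial
  productMonomial = List.foldr (λ w m → unit w ⊕ m) (replicate ℓ 0)

  lookup-productMonomial : ∀ {k} ws → All (_≢ k) ws → lookup (productMonomial ws) k ≡ 0
  lookup-productMonomial {k} []       []         = lookup-replicate k 0
  lookup-productMonomial {k} (w ∷ ws) (w≢k ∷ ws≢k) =
    ≡.trans (lookup-⊕ (unit w) _ k) (≡.cong₂ _+ℕ_ (lookup-unit-≢ w≢k) (lookup-productMonomial ws ws≢k))

  coeff-1P : coeff 1P (replicate ℓ 0) ≈ 1#
  coeff-1P = ≈-trans (coeff-∷ 1# (replicate ℓ 0) [] _) (≈-trans (+-identityʳ _) (δ-≡ {replicate ℓ 0} 1# refl))

  coeff-linearProduct≉0 : ∀ {k} ws → All (_≢ k) ws → coeff (linearProduct k ws) (productMonomial ws) ≉ 0#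
  coeff-linearProduct≉0       []       []           ≈0 = 0≉1 (≈-trans (≈-sym ≈0) coeff-1P)
  coeff-linearProduct≉0 {k} (w ∷ ws) (w≢k ∷ ws≢k) ≈0 = coeff-linearProduct≉0 ws ws≢k (begin
    coeff L m                                                       ≈⟨ -‿involutive _ ⟨
    - - coeff L m                                                   ≈⟨ -‿cong shift ⟨
    - coeff (linearProduct k (w ∷ ws)) (productMonomial (w ∷ ws))  ≈⟨ -‿cong ≈0 ⟩
    - 0#                                                            ≈⟨ -0#≈0# ⟩
    0#                                                              ∎)
    where
    L = linearProduct k ws
    m = productMonomial ws
    shift : coeff ((var k -P var w) *P L) (unit w ⊕ m) ≈ - coeff L m
    shift = coeff-x-x*P-shift L m w≢k (lookup-productMonomial ws ws≢k)

-- Agreement is only claimed up to double negation: equality in K need not be decidable, and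
-- homogeneity only tells us that a coefficient at a monomial of the wrong degree is not nonzero.
module CoefficientAgreement {c e : Level} (K : Field c e) {ℓ : ℕ}
                            (S : Vec ℕ ℓ → Set) (S-⊝ : ∀ m m₁ → S m → S (m ⊝ m₁)) where
  open Field K renaming (refl to ≈-refl; sym to ≈-sym; trans to ≈-trans)
  open Polynomials K ℓ
  open PolynomialRing K ℓ
  open RawMonad (¬¬-Monad {e}) using (pure; _<$>_; zipWith)

  record AgreeOn (p q : Poly) : Set e where
    constructor mkAgree
    field agree-at : ∀ m → S m → ¬ ¬ (coeff p m ≈ coeff q m)
  open AgreeOn public

  AgreeOn-resp-≃ : ∀ {p p′ q q′} → p ≃ p′ → q ≃ q′ → AgreeOn p q → AgreeOn p′ q′
  AgreeOn-resp-≃ p≃p′ q≃q′ p~q = mkAgree λ m Sm →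
    (λ eq → ≈-trans (≈-sym (coeff-≈ p≃p′ m)) (≈-trans eq (coeff-≈ q≃q′ m))) <$> agree-at p~q m Sm

  AgreeOn-+P : ∀ {p p′ q q′} → AgreeOn p q → AgreeOn p′ q′ → AgreeOn (p +P p′) (q +P q′)
  AgreeOn-+P {p} {p′} {q} {q′} p~q p′~q′ =
    mkAgree λ m Sm → zipWith (sum-≈ m) (agree-at p~q m Sm) (agree-at p′~q′ m Sm)
    where
    sum-≈ : ∀ m → coeff p m ≈ coeff q m → coeff p′ m ≈ coeff q′ m →
            coeff (p +P p′) m ≈ coeff (q +P q′) m
    sum-≈ m eq eq′ = ≈-trans (coeff-+P p p′ m) (≈-trans (+-cong eq eq′) (≈-sym (coeff-+P q q′ m)))

  AgreeOn-· : ∀ t {q q′} → AgreeOn q q′ → AgreeOn (t · q) (t · q′)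
  AgreeOn-· (a , m₁) {q} {q′} q~q′ = mkAgree λ m Sm → by-cases m Sm (≡-dec _≟ℕ_ (m₁ ⊕ (m ⊝ m₁)) m)
    where
    by-cases : ∀ m → S m → Dec (m₁ ≼ m) → ¬ ¬ (coeff ((a , m₁) · q) m ≈ coeff ((a , m₁) · q′) m)
    by-cases m Sm (yes m₁≼m) =
      (λ eq → ≈-trans (coeff-·-≼ a q m₁≼m) (≈-trans (*-congˡ eq) (≈-sym (coeff-·-≼ a q′ m₁≼m))))
      <$> agree-at q~q′ (m ⊝ m₁) (S-⊝ m m₁ Sm)
    by-cases m Sm (no m₁⋠m) = pure (≈-trans (coeff-·-⋠ a q m₁⋠m) (≈-sym (coeff-·-⋠ a q′ m₁⋠m)))

  AgreeOn-*P : ∀ p {q q′} → AgreeOn q q′ → AgreeOn (p *P q) (p *P q′)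
  AgreeOn-*P []      q~q′ = mkAgree λ m Sm → pure ≈-refl
  AgreeOn-*P (t ∷ p) q~q′ = AgreeOn-+P (AgreeOn-· t q~q′) (AgreeOn-*P p q~q′)

  AgreeOn-sumP : ∀ {n} {f g : Fin n → Poly} → (∀ r → AgreeOn (f r) (g r)) → AgreeOn (sumP f) (sumP g)
  AgreeOn-sumP {zero}  f~g = mkAgree λ m Sm → pure ≈-refl
  AgreeOn-sumP {suc n} f~g = AgreeOn-+P (f~g Fin.zero) (AgreeOn-sumP (λ r → f~g (Fin.suc r)))

module WalksAndSides {ℓ : ℕ} (G : SimpleGraph ℓ) where
  open SimpleGraph G
  open import Data.List.Relation.Unary.AllPairs using ([]; _∷_)
  open import Data.List.Relation.Unary.All.Properties using (¬Any⇒All¬; All¬⇒¬Any)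
  open import Data.List.Relation.Unary.Any using (here; there; any?)
  open import Data.List.Membership.Propositional using () renaming (_∈_ to _∈ₗ_)

  walk-head : ∀ {P : Fin ℓ → Set} {x y vs} → Walk G x y vs → All P vs → P x
  walk-head (here _)   (px ∷ _) = px
  walk-head (step _ _) (px ∷ _) = px

  path-suffix : ∀ {P : Fin ℓ → Set} {x y z vs} → Path G x y vs → All P vs → z ∈ₗ vs →
                ∃[ us ] (Path G z y us × All P us)
  path-suffix path@(here _ , _)     Pvs       (here refl)  = _ , path , Pvs
  path-suffix path@(step _ _ , _)   Pvs       (here refl)  = _ , path , Pvs
  path-suffix (step _ w , _ ∷ uniq) (_ ∷ Pvs) (there z∈vs) = path-suffix (w , uniq) Pvs z∈vs

  walk⇒path : ∀ {P : Fin ℓ → Set} {x y vs} → Walk G x y vs → All P vs → ∃[ us ] (Path G x y us × All P us)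
  walk⇒path (here x)                 Pvs = _ , (here x , [] ∷ []) , Pvs
  walk⇒path {x = x} (step x~y walk) (Px ∷ Pvs) with walk⇒path walk Pvs
  ... | us , (walk′ , uniq) , Pus with any? (x Fin.≟_) us
  ...   | yes x∈us = path-suffix (walk′ , uniq) Pus x∈us
  ...   | no  x∉us = x ∷ us , (step x~y walk′ , ¬Any⇒All¬ us x∉us ∷ uniq) , Px ∷ Pus

  module _ (T : Subset ℓ) (b : Fin ℓ) where

    ReachesAvoiding : Fin ℓ → Set
    ReachesAvoiding k = ∃[ vs ] (Walk G k b vs × All (_∉ T) vs)

    FarSide : Fin ℓ → Set
    FarSide k = k ∉ T × ¬ ReachesAvoiding k

    FarSide-step : ∀ {i j} → FarSide i → adj i j ≡ true → j ∉ T → FarSide j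
    FarSide-step (i∉T , i↛b) i~j j∉T = j∉T , λ (vs , walk , vs∉T) → i↛b (_ , step i~j walk , i∉T ∷ vs∉T)

    FarSide-boundary : ∀ {i j} → FarSide i → ¬ FarSide j → adj i j ≡ true → j ∈ T
    FarSide-boundary {j = j} Ci ¬Cj i~j = decidable-stable (j ∈? T) (λ j∉T → ¬Cj (FarSide-step Ci i~j j∉T))

    ¬FarSide : b ∉ T → ¬ FarSide b
    ¬FarSide b∉T (_ , b↛b) = b↛b (_ , here b , b∉T ∷ [])

    separated⇒FarSide : ∀ {a} → a ∉ T → Separates G T a b → FarSide a
    separated⇒FarSide a∉T sep = a∉T , λ (vs , walk , vs∉T) →
      let (us , path , us∉T) = walk⇒path walk vs∉T in All¬⇒¬Any us∉T (sep us path)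

module LogarithmicDerivations {c e : Level} (K : Field c e) {ℓ : ℕ} (G : SimpleGraph ℓ) where
  open Field K renaming (refl to ≈-refl; sym to ≈-sym; trans to ≈-trans)
  open Arrangement K G
  open PolynomialRing K ℓ
  open LinearFormCoefficients K ℓ using (coeff-x-x*P-vanishes)
  open SimpleGraph G using (adj)
  open import Algebra.Properties.Group +-group using (x∙y⁻¹≈ε⇒x≈y)
  open import Relation.Binary.Reasoning.Setoid setoid

  module _ (θ : Der) (θ∈D : InD θ) where

    InD-coeff-edge : ∀ {i j m} → adj i j ≡ true → lookup m i ≡ 0 → lookup m j ≡ 0 → coeff (θ i) m ≈ coeff (θ j) m
    InD-coeff-edge {i} {j} {m} i~j mᵢ≡0 mⱼ≡0 with θ∈D i j i~j
    ... | q , θᵢ-θⱼ≋ = x∙y⁻¹≈ε⇒x≈y _ _ (begin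
      coeff (θ i) m - coeff (θ j) m      ≈⟨ +-congˡ (coeff-negP (θ j) m) ⟨
      coeff (θ i) m + coeff (-P θ j) m   ≈⟨ coeff-+P (θ i) (-P θ j) m ⟨
      coeff (θ i -P θ j) m               ≈⟨ θᵢ-θⱼ≋ m ⟩
      coeff ((var i -P var j) *P q) m    ≈⟨ coeff-x-x*P-vanishes i j q mᵢ≡0 mⱼ≡0 ⟩
      0#                                 ∎)

    InD-coeff-walk : ∀ {x y vs m} → Walk G x y vs → All (λ v → lookup m v ≡ 0) vs → coeff (θ x) m ≈ coeff (θ y) m
    InD-coeff-walk (here _)        _            = ≈-refl
    InD-coeff-walk (step x~y walk) (mₓ≡0 ∷ m≡0) =
      ≈-trans (InD-coeff-edge x~y mₓ≡0 (WalksAndSides.walk-head G walk m≡0)) (InD-coeff-walk walk m≡0)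

¬¬-decidable : ∀ {n} (P : Fin n → Set) → ¬ ¬ (∀ k → Dec (P k))
¬¬-decidable {zero}  P ¬dec = ¬dec λ ()
¬¬-decidable {suc n} P ¬dec = ¬¬-excluded-middle λ P₀? →
  ¬¬-decidable (λ k → P (Fin.suc k)) λ Pₛ? → ¬dec λ { Fin.zero → P₀? ; (Fin.suc k) → Pₛ? k }

module MinimalSeparatorBound {c e : Level} (K : Field c e) {ℓ : ℕ} (G : SimpleGraph ℓ)
                             {T : Subset ℓ} {a b : Fin ℓ} (a∉T : a ∉ T) (b∉T : b ∉ T)
                             (T-separates : Separates G T a b)
                             (T-minimal : ∀ T′ → T′ ⊂ T → ¬ Separates G T′ a b) where
  open Field K renaming (refl to ≈-refl; sym to ≈-sym; trans to ≈-trans)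
  open Arrangement K G
  open PolynomialRing K ℓ
  open LinearFormCoefficients K ℓ
  open WalksAndSides G
  open LogarithmicDerivations K G
  open SimpleGraph G using (symm)
  open RawMonad (¬¬-Monad {e}) using (zipWith)
  open import Data.Fin.Subset using () renaming (_-_ to _-ˢ_)
  open import Data.Fin.Subset.Properties using (x∈p⇒p-x⊂p; x∈p∧x≢y⇒x∈p-y)
  open import Data.List.Relation.Unary.Any using (any?)
  open import Data.List.Relation.Unary.All.Properties using (¬Any⇒All¬)
  import Data.List.Relation.Unary.All as All
  open import Data.List.Membership.Propositional using () renaming (_∈_ to _∈ₗ_)
  open import Data.List.Membership.Propositional.Properties using (∈-filter⁺; ∈-filter⁻; ∈-allFin)
  open import Data.Fin.Properties using () renaming (any? to Fin-any?)
  open import Data.Nat using (_<_; _∸_)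
  open import Data.Nat.Properties using (<-irrefl; <-≤-trans; 0∸n≡0)
  open import Relation.Binary.Reasoning.Setoid setoid

  SupportedInT : Monomial → Set
  SupportedInT m = ∀ k → k ∉ T → lookup m k ≡ 0

  SupportedInT-⊝ : ∀ m m₁ → SupportedInT m → SupportedInT (m ⊝ m₁)
  SupportedInT-⊝ m m₁ supp k k∉T =
    ≡.trans (lookup-⊝ m m₁ k) (≡.trans (≡.cong (_∸ lookup m₁ k) (supp k k∉T)) (0∸n≡0 (lookup m₁ k)))

  open CoefficientAgreement K SupportedInT SupportedInT-⊝

  minimality-detour : ∀ {v} → v ∈ T → ¬ ¬ (∃[ vs ] (Path G a b vs × All (_∉ T -ˢ v) vs))
  minimality-detour {v} v∈T ¬detour = T-minimal (T -ˢ v) (x∈p⇒p-x⊂p v∈T) λ vs path →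
    decidable-stable (any? (_∈? T -ˢ v) vs) λ ¬meets → ¬detour (vs , path , ¬Any⇒All¬ vs ¬meets)

  agree-if-vanishing-on-T : ∀ θ → InD θ → ∀ m {v} → SupportedInT m → v ∈ T → lookup m v ≡ 0 →
                            ¬ ¬ (coeff (θ a) m ≈ coeff (θ b) m)
  agree-if-vanishing-on-T θ θ∈D m {v} supp v∈T mᵥ≡0 =
    ¬¬-map (λ (vs , (walk , _) , vs∉T-v) → InD-coeff-walk θ θ∈D walk (All.map vanishes vs∉T-v))
           (minimality-detour v∈T)
    where
    vanishes : ∀ {u} → u ∉ T -ˢ v → lookup m u ≡ 0
    vanishes {u} u∉T-v with u ∈? T | u Fin.≟ v
    ... | no  u∉T | _        = supp u u∉T
    ... | yes _   | yes refl = mᵥ≡0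
    ... | yes u∈T | no  u≢v  = contradiction (x∈p∧x≢y⇒x∈p-y u∈T u≢v) u∉T-v

  homogeneous-vanishes : ∀ {d} p m → Homogeneous d p → totalDegree m ≢ d → ¬ ¬ (coeff p m ≈ 0#)
  homogeneous-vanishes p m hom m≢d coeff≉0 = m≢d (hom m coeff≉0)

  low-degree-agree : ∀ {d} θ → InD θ → HomogeneousDer d θ → d < ∣ T ∣ → AgreeOn (θ a) (θ b)
  low-degree-agree {d} θ θ∈D hom d<∣T∣ = mkAgree λ m supp →
    by-cases m supp (Fin-any? λ v → (v ∈? T) ×-dec (lookup m v ≟ℕ 0))
    where
    by-cases : ∀ m → SupportedInT m → Dec (∃[ v ] (v ∈ T × lookup m v ≡ 0)) →
               ¬ ¬ (coeff (θ a) m ≈ coeff (θ b) m)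
    by-cases m supp (yes (v , v∈T , mᵥ≡0)) = agree-if-vanishing-on-T θ θ∈D m supp v∈T mᵥ≡0
    by-cases m supp (no ∄gap) = zipWith (λ θₐ≈0 θ_b≈0 → ≈-trans θₐ≈0 (≈-sym θ_b≈0))
      (homogeneous-vanishes (θ a) m (hom a) m≢d) (homogeneous-vanishes (θ b) m (hom b) m≢d)
      where
      m≢d : totalDegree m ≢ d
      m≢d m≡d = <-irrefl refl (<-≤-trans d<∣T∣ (≡.subst (∣ T ∣ ≤_) m≡d ∣T∣≤deg-m))
        where
        ∣T∣≤deg-m : ∣ T ∣ ≤ totalDegree m
        ∣T∣≤deg-m = ∣p∣≤sum T m λ v v∈T mᵥ≡0 → ∄gap (v , v∈T , mᵥ≡0)

  elementsT : List (Fin ℓ)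
  elementsT = List.filter (_∈? T) (List.allFin ℓ)

  ∈-elementsT : ∀ {v} → v ∈ T → v ∈ₗ elementsT
  ∈-elementsT {v} v∈T = ∈-filter⁺ (_∈? T) (∈-allFin v) v∈T

  elementsT-≢ : ∀ {k} → k ∉ T → All (_≢ k) elementsT
  elementsT-≢ k∉T = All.tabulate λ v∈elementsT v≡k →
    k∉T (≡.subst (_∈ T) v≡k (proj₂ (∈-filter⁻ (_∈? T) {xs = List.allFin ℓ} v∈elementsT)))

  SupportedInT-productMonomial : SupportedInT (productMonomial elementsT)
  SupportedInT-productMonomial k k∉T = lookup-productMonomial elementsT (elementsT-≢ k∉T)

  module _ (FarSide? : ∀ k → Dec (FarSide T b k)) where
    open LinearProducts +P-*P-commutativeRing var
      using (_when_; when-yes; when-no; x-x∣linearProduct-when-difference)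

    farSideDerivation : Der
    farSideDerivation k = linearProduct k elementsT when FarSide? k

    farSideDerivation-InD : InD farSideDerivation
    farSideDerivation-InD i j i~j = ∣⇒∣P
      (x-x∣linearProduct-when-difference i j elementsT (FarSide? i) (FarSide? j)
        (λ Cᵢ ¬Cⱼ → ∈-elementsT (FarSide-boundary T b Cᵢ ¬Cⱼ i~j))
        (λ Cⱼ ¬Cᵢ → ∈-elementsT (FarSide-boundary T b Cⱼ ¬Cᵢ (≡.trans (symm j i) i~j))))

    farSideDerivation-disagree : ¬ AgreeOn (farSideDerivation a) (farSideDerivation b)
    farSideDerivation-disagree agree = agree-at agree m* SupportedInT-productMonomial λ θₐ≈θ_b →
      coeff-linearProduct≉0 elementsT (elementsT-≢ a∉T) (begin
        coeff (linearProduct a elementsT) m*  ≡⟨ ≡.cong (λ p → coeff p m*) (when-yes (FarSide? a) Cₐ) ⟨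
        coeff (farSideDerivation a) m*        ≈⟨ θₐ≈θ_b ⟩
        coeff (farSideDerivation b) m*        ≡⟨ ≡.cong (λ p → coeff p m*) (when-no (FarSide? b) ¬C_b) ⟩
        coeff 0P m*                           ∎)
      where
      m* = productMonomial elementsT
      Cₐ = separated⇒FarSide T b a∉T T-separates
      ¬C_b = ¬FarSide T b b∉T

  low-degree-¬generates : ∀ {n} (θs : Fin n → Der) (deg : Fin n → ℕ) → (∀ r → InD (θs r)) →
                          (∀ r → HomogeneousDer (deg r) (θs r)) → (∀ r → deg r < ∣ T ∣) →
                          ¬ Generates θs
  low-degree-¬generates θs deg inD hom low generates = ¬¬-decidable (FarSide T b) λ FarSide? →
    let θ       = farSideDerivation FarSide?
        (g , θ≋) = generates θ (farSideDerivation-InD FarSide?)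
    in farSideDerivation-disagree FarSide? (AgreeOn-resp-≃ (≃-sym (mk≃ (θ≋ a))) (≃-sym (mk≃ (θ≋ b)))
         (AgreeOn-sumP λ r → AgreeOn-*P (g r) (low-degree-agree (θs r) (inD r) (hom r) (low r))))

corollary4p11 : ∀ {c e : Level} (K : Field c e) {ℓ : ℕ} (G : SimpleGraph ℓ) →
    Connected G →
    ∀ {n : ℕ} (B : Arrangement.MinimalHomogeneousGenerators K G n) →
    ∀ (T : Subset ℓ) → IsMinimalSeparator G T →
    ∃[ r ] (∣ T ∣ ≤ Arrangement.MinimalHomogeneousGenerators.deg B r)
corollary4p11 K G _ B T (a , b , a∉T , b∉T , T-separates , T-minimal) =
  decidable-stable (Fin-any? λ r → ∣ T ∣ ≤? deg r) λ ∄r →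
    low-degree-¬generates gen deg inD homogeneous (λ r → ≰⇒> λ ∣T∣≤deg → ∄r (r , ∣T∣≤deg))
                          generates
  where
  open Arrangement.MinimalHomogeneousGenerators B
  open MinimalSeparatorBound K G a∉T b∉T T-separates T-minimal using (low-degree-¬generates)
  open import Data.Fin.Properties using () renaming (any? to Fin-any?)
  open import Data.Nat.Properties using (_≤?_; ≰⇒>)
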